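{- Let $A$ be a set partition of $\{1,\dots,n\}$. Let $M(A)=(m_{i,j})$ be the $n\times n$ matrix with $m_{i,j}=1$ if $(i,j)$ is an arc of $A$ and $m_{i,j}=0$ otherwise. Let $R=(r_{i,j})_{i,j=1}^n$ be its rank control matrix. Then: (1) $\mathtt{t}(A)=\mathtt{D}(A)$, where $\mathtt{D}(A)=\#\{(i,j): 2\le i\le n,\ 1\le j\le n-1,\ r_{i,j}\neq r_{i-1,j+1}\}$; (2) $\mathtt{i}(A)=\mathtt{E}(A)$, where $\mathtt{E}(A)=\#\{(i,j): 2\le i\le j+1\le n,\ r_{i,j}=r_{i-1,j+1}\}$.
   Context: Arcs of $A$: pairs $(i,j)$, $i<j$, of elements in the same block with no element of that block strictly between them. Let $m$ be the number of arcs. Rank control matrix: $r_{i,j}$ is the rank of the submatrix of $M(A)$ formed by rows $i,\dots,n$ and columns $1,\dots,j$. Equivalently, $r_{i,j}$ is the number of arcs $(k,l)$ of $A$ with $i\le k<l\le j$. Depth index: $\mathrm{depth}(v)$ is the number of arcs $(i,j)$ with $i<v<j$; for an arc $\alpha=(u,v)$, $\mathrm{depth}(\alpha)$ is the number of arcs $(i,j)$ with $i<u<v<j$. Then \[ \mathtt{t}(A)=\sum_{i=1}^{m}(n-i)-\sum_{v=1}^n\mathrm{depth}(v)+\sum_{\alpha\text{ arc}}\mathrm{depth}(\alpha). \] Intertwining number: for disjoint blocks $B,C$, count the pairs $(b,c)\in B\times C$ with $\{\min(b,c)+1,\dots,\max(b,c)-1\}\cap(B\cup C)=\emptyset$. $\mathtt{i}(A)$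 is the sum of this count over all unordered pairs of distinct blocks. -}

module Defs where

open import Data.Bool using (Bool; true; false; _∧_; _∨_; not; if_then_else_)
open import Data.Nat using (ℕ; zero; suc; _+_; _*_; _∸_; _≡ᵇ_; _<ᵇ_; _≤ᵇ_)
open import Data.List using (List; []; _∷_; map; upTo)
open import Data.Integer using (ℤ; +_) renaming (_+_ to _+ℤ_; _-_ to _-ℤ_)

-- A set partition of {1,…,n} is encoded by a block-labelling function
-- A : ℕ → ℕ : elements k, l ∈ {1,…,n} lie in the same block iff A k ≡ A l.
-- Values of A outside {1,…,n} are never consulted.  Every set partition
-- of {1,…,n} arises this way and all quantities below depend only on the
-- induced partition.
Labelling : Set
Labelling = ℕ → ℕ

-- the list [a, a+1, …, b]  (empty if b < a)
range : ℕ → ℕ → List ℕ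
range a b = map (λ k → a + k) (upTo (suc b ∸ a))

sumL : List ℕ → (ℕ → ℕ) → ℕ
sumL []       f = 0
sumL (x ∷ xs) f = f x + sumL xs f

sumLℤ : List ℕ → (ℕ → ℤ) → ℤ
sumLℤ []       f = + 0
sumLℤ (x ∷ xs) f = f x +ℤ sumLℤ xs f

sumR : ℕ → ℕ → (ℕ → ℕ) → ℕ
sumR a b f = sumL (range a b) f

sumRℤ : ℕ → ℕ → (ℕ → ℤ) → ℤ
sumRℤ a b f = sumLℤ (range a b) f

ind : Bool → ℕ
ind b = if b then 1 else 0

countR : ℕ → ℕ → (ℕ → Bool) → ℕ
countR a b p = sumR a b (λ k → ind (p k))

anyR : ℕ → ℕ → (ℕ → Bool) → Bool
anyR a b p = not (countR a b p ≡ᵇ 0)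

module _ (n : ℕ) (A : Labelling) where

  same : ℕ → ℕ → Bool
  same k l = A k ≡ᵇ A l

  isArc : ℕ → ℕ → Bool
  isArc i j = (1 ≤ᵇ i) ∧ (i <ᵇ j) ∧ (j ≤ᵇ n) ∧ same i j
              ∧ not (anyR (suc i) (j ∸ 1) (λ k → same i k))

  countArcs : (ℕ → ℕ → Bool) → ℕ
  countArcs p = sumR 1 n (λ k → countR 1 n (λ l → isArc k l ∧ p k l))

  numArcs : ℕ
  numArcs = countArcs (λ _ _ → true)

  M : ℕ → ℕ → ℕ
  M i j = ind (isArc i j)

  -- rank control matrix: r_{i,j} = number of arcs (k,l) with i ≤ k < l ≤ j
  -- (= rank of rows i..n, columns 1..j of the partial permutation matrix M(A))
  r : ℕ → ℕ → ℕ
  r i j = countArcs (λ k l → (i ≤ᵇ k) ∧ (l ≤ᵇ j))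

  depthV : ℕ → ℕ
  depthV v = countArcs (λ i j → (i <ᵇ v) ∧ (v <ᵇ j))

  depthArc : ℕ → ℕ → ℕ
  depthArc u v = countArcs (λ i j → (i <ᵇ u) ∧ (v <ᵇ j))

  tStat : ℤ
  tStat = (sumRℤ 1 numArcs (λ i → (+ n) -ℤ (+ i))
            -ℤ (+ sumR 1 n depthV))
            +ℤ (+ sumR 1 n (λ u → sumR 1 n (λ v → ind (isArc u v) * depthArc u v)))

  isMin : ℕ → Bool
  isMin x = not (anyR 1 (x ∸ 1) (λ y → same x y))

  intertw : ℕ → ℕ → ℕ
  intertw x y =
    sumR 1 n (λ b → ind (same x b) * countR 1 n (λ c → same y c ∧ noBetween b c))
    where
    inBC : ℕ → Bool
    inBC k = same x k ∨ same y k
    noBetween : ℕ → ℕ → Bool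
    noBetween b c =
      if b <ᵇ c then not (anyR (suc b) (c ∸ 1) inBC)
                else not (anyR (suc c) (b ∸ 1) inBC)

  -- i(A): sum over unordered pairs {B,C} of distinct blocks; each block is
  -- represented by its minimal element, pairs enumerated as x < y
  iStat : ℕ
  iStat = sumR 1 n (λ x → sumR 1 n (λ y →
            ind (isMin x ∧ isMin y ∧ (x <ᵇ y)) * intertw x y))

  DStat : ℕ
  DStat = sumR 2 n (λ i → countR 1 (n ∸ 1) (λ j →
            not (r i j ≡ᵇ r (i ∸ 1) (suc j))))

  EStat : ℕ
  EStat = sumR 2 n (λ i → countR 1 n (λ j →
            (i ≤ᵇ suc j) ∧ (suc j ≤ᵇ n) ∧ (r i j ≡ᵇ r (i ∸ 1) (suc j))))

{-# OPTIONS --safe #-}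
-- Both statistics classify the pairs a < b of {1, …, n} by whether [a, b] contains a boundary
-- arc: an arc (a, l) with l ≤ b or an arc (k, b) with a ≤ k.  Since r_{a,b} − r_{a+1,b−1}
-- counts exactly the arcs inside [a, b] with an endpoint at a or b, r_{i,j} ≠ r_{i−1,j+1} iff
-- (i − 1, j + 1) has a boundary arc: D counts the pairs with one and E the pairs without.
--
-- (2) For b < c in distinct blocks B ∋ b and C ∋ c, some element of B ∪ C lies strictly
-- between b and c iff (b, c) has a boundary arc: the first such element of B yields an arc
-- leaving b inside [b, c], the last such element of C an arc entering c.  Summing over pairs
-- of blocks, indexed by their minima, thus counts the pairs b < c without a boundary arc,
-- which never lie in a single block.
--
-- (1) Induction on n: adding the vertex n + 1 adds the pairs (a, n + 1).  If n + 1 begins its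
-- block, such a pair has a boundary arc iff a begins an arc, so m pairs are new, and t grows by
-- m since each of its m terms n − i does.  If n + 1 closes an arc (p, n + 1), the new pairs are
-- the p pairs with a ≤ p and the Z pairs with p < a where a begins an arc; t gains n from its
-- first sum, loses the n − p new vertex depths and gains the Z new arc depths.
module Submission where

open import Defs
open import Data.Nat using (ℕ)
open import Data.Integer using (+_)
open import Data.Product using (_×_)
open import Relation.Binary.PropositionalEquality using (_≡_)

open import Data.Bool using (Bool; true; false; _∧_; _∨_; not; if_then_else_)
open import Data.Bool.Properties using (not-involutive; ∨-comm; ∧-identityʳ)
open import Data.Nat
  using (zero; suc; _+_; _*_; _∸_; _≤_; _<_; s≤s; s≤s⁻¹; z<s; _≤ᵇ_; _<ᵇ_; _≡ᵇ_)
open import Data.Nat.Properties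
open import Data.List using ([]; _∷_; _++_; _∷ʳ_; map; upTo; applyUpTo)
open import Data.List.Properties using (map-applyUpTo; applyUpTo-∷ʳ)
open import Data.List.Relation.Unary.Any using (Any; here; there)
open import Data.List.Membership.Propositional using (_∈_; find; lose)
open import Data.List.Membership.Propositional.Properties using (∈-map⁺; ∈-map⁻; ∈-upTo⁺; ∈-upTo⁻)
open import Data.Product using (∃-syntax; _,_; proj₁; proj₂)
open import Data.Sum using (_⊎_; inj₁; inj₂)
open import Data.Integer using (ℤ) renaming (_+_ to _+ℤ_; _-_ to _-ℤ_)
import Data.Integer.Properties as ℤ
open import Algebra.Properties.CommutativeSemigroup +-commutativeSemigroup
  renaming (interchange to +-interchange) using ()
open import Data.Nat.Tactic.RingSolver using (solve-∀)
import Data.Integer.Tactic.RingSolver as ℤ-Solver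
open import Function using (_∘_; id)
open import Relation.Nullary using (¬_; contradiction; Dec; _because_; yes; no)
open import Relation.Binary.Definitions using (tri<; tri≈; tri>)
open import Induction.WellFounded using (Acc; acc)
open import Data.Nat.Induction using (<-wellFounded)
open import Relation.Nullary.Reflects
  using (Reflects; ofʸ; ofⁿ; det; fromEquivalence; T-reflects; _×-reflects_; _⊎-reflects_; ¬-reflects)
open import Relation.Binary.PropositionalEquality using (_≢_; refl; sym; trans; cong; cong₂; subst; module ≡-Reasoning)

reflects-map : ∀ {P Q : Set} {b} → (P → Q) → (Q → P) → Reflects P b → Reflects Q b
reflects-map f g (ofʸ p)  = ofʸ (f p)
reflects-map f g (ofⁿ ¬p) = ofⁿ (¬p ∘ g)

witness : ∀ {P : Set} {b} → Reflects P b → b ≡ true → P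
witness (ofʸ p) refl = p

≡true : ∀ {P : Set} {b} → Reflects P b → P → b ≡ true
≡true r p = det r (ofʸ p)

≡false : ∀ {P : Set} {b} → Reflects P b → ¬ P → b ≡ false
≡false r ¬p = det r (ofⁿ ¬p)

≡ᵇ-reflects-≡ : ∀ m n → Reflects (m ≡ n) (m ≡ᵇ n)
≡ᵇ-reflects-≡ m n = fromEquivalence (≡ᵇ⇒≡ m n) (≡⇒≡ᵇ m n)

<⇒≤∸1 : ∀ {k b} → k < b → k ≤ b ∸ 1
<⇒≤∸1 (s≤s k≤b) = k≤b

≤∸1⇒< : ∀ {k b} → 0 < k → k ≤ b ∸ 1 → k < b
≤∸1⇒< {b = zero}  0<k k≤0 = contradiction k≤0 (<⇒≱ 0<k)
≤∸1⇒< {b = suc b} _   k≤b = s≤s k≤b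

<∸⇒+< : ∀ a {t n} → t < n ∸ a → a + t < n
<∸⇒+< zero                lt = lt
<∸⇒+< (suc a) {n = suc n} lt = s≤s (<∸⇒+< a lt)

∈-range⁻ : ∀ {a b k} → k ∈ range a b → a ≤ k × k ≤ b
∈-range⁻ {a} k∈ with t , t∈ , refl ← ∈-map⁻ (_+_ a) k∈ = m≤m+n a t , s≤s⁻¹ (<∸⇒+< a (∈-upTo⁻ t∈))

∈-range⁺ : ∀ {a b k} → a ≤ k → k ≤ b → k ∈ range a b
∈-range⁺ {a} a≤k k≤b =
  subst (_∈ range _ _) (m+[n∸m]≡n a≤k) (∈-map⁺ (_+_ a) (∈-upTo⁺ (∸-monoˡ-< (s≤s k≤b) a≤k)))

sumL-ind-reflects : ∀ {P : ℕ → Set} {p : ℕ → Bool} → (∀ k → Reflects (P k) (p k)) →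
                    ∀ xs → Reflects (Any P xs) (not (sumL xs (λ k → ind (p k)) ≡ᵇ 0))
sumL-ind-reflects r []                     = ofⁿ λ ()
sumL-ind-reflects {p = p} r (x ∷ xs) with p x | r x
... | true  | ofʸ px  = ofʸ (here px)
... | false | ofⁿ ¬px = reflects-map there (λ { (here px) → contradiction px ¬px ; (there a) → a })
                                       (sumL-ind-reflects r xs)

anyR-reflects : ∀ {P : ℕ → Set} {p : ℕ → Bool} a b → (∀ k → Reflects (P k) (p k)) →
                Reflects (∃[ k ] a ≤ k × k ≤ b × P k) (anyR a b p)
anyR-reflects {P} a b r = reflects-map fromAny toAny (sumL-ind-reflects r (range a b))
  where
  fromAny : Any P (range a b) → ∃[ k ] a ≤ k × k ≤ b × P k
  fromAny any with k , k∈ , pk ← find any = k , proj₁ (∈-range⁻ k∈) , proj₂ (∈-range⁻ k∈) , pk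
  toAny : ∃[ k ] a ≤ k × k ≤ b × P k → Any P (range a b)
  toAny (k , a≤k , k≤b , pk) = lose (∈-range⁺ a≤k k≤b) pk

anyR-between-reflects : ∀ {P : ℕ → Set} {p : ℕ → Bool} a b → (∀ k → Reflects (P k) (p k)) →
                        Reflects (∃[ k ] a < k × k < b × P k) (anyR (suc a) (b ∸ 1) p)
anyR-between-reflects a b r = reflects-map
  (λ (k , a<k , k≤b-1 , pk) → k , a<k , ≤∸1⇒< (<-≤-trans z<s a<k) k≤b-1 , pk)
  (λ (k , a<k , k<b , pk) → k , a<k , <⇒≤∸1 k<b , pk)
  (anyR-reflects (suc a) (b ∸ 1) r)

sumL-cong : ∀ xs {f g : ℕ → ℕ} → (∀ k → f k ≡ g k) → sumL xs f ≡ sumL xs g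
sumL-cong []       eq = refl
sumL-cong (x ∷ xs) eq = cong₂ _+_ (eq x) (sumL-cong xs eq)

anyR-cong : ∀ a b {p q : ℕ → Bool} → (∀ k → p k ≡ q k) → anyR a b p ≡ anyR a b q
anyR-cong a b eq = cong (λ s → not (s ≡ᵇ 0)) (sumL-cong (range a b) (λ k → cong ind (eq k)))

m≡ᵇm+n≡n≡ᵇ0 : ∀ m n → (m ≡ᵇ m + n) ≡ (n ≡ᵇ 0)
m≡ᵇm+n≡n≡ᵇ0 zero    zero    = refl
m≡ᵇm+n≡n≡ᵇ0 zero    (suc n) = refl
m≡ᵇm+n≡n≡ᵇ0 (suc m) n       = m≡ᵇm+n≡n≡ᵇ0 m n

≡ᵇ0-reflects-¬ : ∀ {P : Set} x → (P → 0 < x) → (¬ P → x ≡ 0) → Reflects (¬ P) (x ≡ᵇ 0)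
≡ᵇ0-reflects-¬ zero    hit _    = ofʸ (λ p → <-irrefl refl (hit p))
≡ᵇ0-reflects-¬ (suc x) _   miss = ofⁿ (λ ¬p → contradiction (miss ¬p) λ ())

∑ : ℕ → (ℕ → ℕ) → ℕ
∑ zero    f = 0
∑ (suc n) f = ∑ n f + f (suc n)

sumL-++ : ∀ xs ys f → sumL (xs ++ ys) f ≡ sumL xs f + sumL ys f
sumL-++ []       ys f = refl
sumL-++ (x ∷ xs) ys f = trans (cong (_+_ (f x)) (sumL-++ xs ys f)) (sym (+-assoc (f x) _ _))

sumLℤ-++ : ∀ xs ys f → sumLℤ (xs ++ ys) f ≡ sumLℤ xs f +ℤ sumLℤ ys f
sumLℤ-++ []       ys f = sym (ℤ.+-identityˡ _)
sumLℤ-++ (x ∷ xs) ys f = trans (cong (f x +ℤ_) (sumLℤ-++ xs ys f)) (sym (ℤ.+-assoc (f x) _ _))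

sumL-map : ∀ (g : ℕ → ℕ) xs f → sumL (map g xs) f ≡ sumL xs (f ∘ g)
sumL-map g []       f = refl
sumL-map g (x ∷ xs) f = cong (_+_ (f (g x))) (sumL-map g xs f)

range-1-suc : ∀ n → range 1 (suc n) ≡ range 1 n ∷ʳ suc n
range-1-suc n = begin
  map suc (upTo (suc n))     ≡⟨ map-applyUpTo id suc (suc n) ⟩
  applyUpTo suc (suc n)      ≡⟨ applyUpTo-∷ʳ suc n ⟨
  applyUpTo suc n ∷ʳ suc n   ≡⟨ cong (_∷ʳ suc n) (map-applyUpTo id suc n) ⟨
  map suc (upTo n) ∷ʳ suc n  ∎
  where open ≡-Reasoning

sumR-1≡∑ : ∀ n f → sumR 1 n f ≡ ∑ n f
sumR-1≡∑ zero    f = refl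
sumR-1≡∑ (suc n) f = begin
  sumL (range 1 (suc n)) f        ≡⟨ cong (λ xs → sumL xs f) (range-1-suc n) ⟩
  sumL (range 1 n ∷ʳ suc n) f     ≡⟨ sumL-++ (range 1 n) _ f ⟩
  sumR 1 n f + (f (suc n) + 0)    ≡⟨ cong₂ _+_ (sumR-1≡∑ n f) (+-identityʳ _) ⟩
  ∑ n f + f (suc n)               ∎
  where open ≡-Reasoning

sumR-2≡∑ : ∀ n f → sumR 2 n f ≡ ∑ (n ∸ 1) (f ∘ suc)
sumR-2≡∑ n f = trans (sumL-map (_+_ 2) (upTo (n ∸ 1)) f)
            (trans (sym (sumL-map suc (upTo (n ∸ 1)) (f ∘ suc))) (sumR-1≡∑ (n ∸ 1) (f ∘ suc)))

sumRℤ-1-suc : ∀ m g → sumRℤ 1 (suc m) g ≡ sumRℤ 1 m g +ℤ g (suc m)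
sumRℤ-1-suc m g = trans (cong (λ xs → sumLℤ xs g) (range-1-suc m))
                 (trans (sumLℤ-++ (range 1 m) _ g) (cong (sumRℤ 1 m g +ℤ_) (ℤ.+-identityʳ _)))

n≡0⇒m+n≡m : ∀ m {n} → n ≡ 0 → m + n ≡ m
n≡0⇒m+n≡m m refl = +-identityʳ m

∑-cong : ∀ n {f g : ℕ → ℕ} → (∀ {k} → 1 ≤ k → k ≤ n → f k ≡ g k) → ∑ n f ≡ ∑ n g
∑-cong zero    eq = refl
∑-cong (suc n) eq = cong₂ _+_ (∑-cong n (λ 1≤k k≤n → eq 1≤k (m≤n⇒m≤1+n k≤n))) (eq z<s ≤-refl)

∑-cong′ : ∀ n {f g : ℕ → ℕ} → (∀ k → f k ≡ g k) → ∑ n f ≡ ∑ n g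
∑-cong′ n eq = ∑-cong n (λ {k} _ _ → eq k)

∑-zero : ∀ n {f : ℕ → ℕ} → (∀ {k} → 1 ≤ k → k ≤ n → f k ≡ 0) → ∑ n f ≡ 0
∑-zero zero    eq = refl
∑-zero (suc n) eq = cong₂ _+_ (∑-zero n (λ 1≤k k≤n → eq 1≤k (m≤n⇒m≤1+n k≤n))) (eq z<s ≤-refl)

∑-distrib-+ : ∀ n (f g : ℕ → ℕ) → ∑ n (λ k → f k + g k) ≡ ∑ n f + ∑ n g
∑-distrib-+ zero    f g = refl
∑-distrib-+ (suc n) f g = begin
  ∑ n (λ k → f k + g k) + (f (suc n) + g (suc n)) ≡⟨ cong (_+ (f (suc n) + g (suc n))) (∑-distrib-+ n f g) ⟩
  (∑ n f + ∑ n g) + (f (suc n) + g (suc n))       ≡⟨ +-interchange (∑ n f) (∑ n g) _ _ ⟩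
  (∑ n f + f (suc n)) + (∑ n g + g (suc n))       ∎
  where open ≡-Reasoning

∑-distribˡ-* : ∀ n c (f : ℕ → ℕ) → ∑ n (λ k → c * f k) ≡ c * ∑ n f
∑-distribˡ-* zero    c f = sym (*-zeroʳ c)
∑-distribˡ-* (suc n) c f =
  trans (cong (_+ c * f (suc n)) (∑-distribˡ-* n c f)) (sym (*-distribˡ-+ c (∑ n f) (f (suc n))))

∑-distribʳ-* : ∀ n c (f : ℕ → ℕ) → ∑ n (λ k → f k * c) ≡ ∑ n f * c
∑-distribʳ-* n c f =
  trans (∑-cong′ n (λ k → *-comm (f k) c)) (trans (∑-distribˡ-* n c f) (*-comm c (∑ n f)))

∑-single : ∀ n {f : ℕ → ℕ} p → 1 ≤ p → p ≤ n →
           (∀ {k} → 1 ≤ k → k ≤ n → k ≢ p → f k ≡ 0) → ∑ n f ≡ f p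
∑-single zero    p 1≤p p≤0 _ = contradiction p≤0 (<⇒≱ 1≤p)
∑-single (suc n) {f} p 1≤p p≤1+n others with m≤n⇒m<n∨m≡n p≤1+n
... | inj₁ p<1+n = begin
  ∑ n f + f (suc n) ≡⟨ cong₂ _+_ (∑-single n p 1≤p p≤n (λ 1≤k k≤n → others 1≤k (m≤n⇒m≤1+n k≤n)))
                                 (others z<s ≤-refl (>⇒≢ p<1+n)) ⟩
  f p + 0           ≡⟨ +-identityʳ (f p) ⟩
  f p               ∎
  where
  open ≡-Reasoning
  p≤n = s≤s⁻¹ p<1+n
... | inj₂ refl = cong (_+ f (suc n))
  (∑-zero n (λ 1≤k k≤n → others 1≤k (m≤n⇒m≤1+n k≤n) (<⇒≢ (s≤s k≤n))))

∑-swap : ∀ m n (f : ℕ → ℕ → ℕ) → ∑ m (λ a → ∑ n (λ b → f a b)) ≡ ∑ n (λ b → ∑ m (λ a → f a b))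
∑-swap zero    n f = sym (∑-zero n (λ _ _ → refl))
∑-swap (suc m) n f = trans (cong (_+ ∑ n (f (suc m))) (∑-swap m n f))
                          (sym (∑-distrib-+ n (λ b → ∑ m (λ a → f a b)) (f (suc m))))

∑-front : ∀ n f → ∑ (suc n) f ≡ f 1 + ∑ n (f ∘ suc)
∑-front zero    f = +-comm 0 (f 1)
∑-front (suc n) f = trans (cong (_+ f (suc (suc n))) (∑-front n f)) (+-assoc (f 1) _ _)

term≤∑ : ∀ n f {k} → 1 ≤ k → k ≤ n → f k ≤ ∑ n f
term≤∑ zero    f 1≤k k≤0 = contradiction k≤0 (<⇒≱ 1≤k)
term≤∑ (suc n) f 1≤k k≤1+n with m≤n⇒m<n∨m≡n k≤1+n
... | inj₁ k<1+n = ≤-trans (term≤∑ n f 1≤k (s≤s⁻¹ k<1+n)) (m≤m+n (∑ n f) _)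
... | inj₂ refl  = m≤n+m _ (∑ n f)

∑-one : ∀ n → ∑ n (λ _ → 1) ≡ n
∑-one zero    = refl
∑-one (suc n) = trans (cong (_+ 1) (∑-one n)) (+-comm n 1)

∑-select : ∀ n p (g : ℕ → ℕ) → 1 ≤ p → p ≤ n → ∑ n (λ x → ind (x ≡ᵇ p) * g x) ≡ g p
∑-select n p g 1≤p p≤n = begin
  ∑ n (λ x → ind (x ≡ᵇ p) * g x) ≡⟨ ∑-single n p 1≤p p≤n elsewhere ⟩
  ind (p ≡ᵇ p) * g p              ≡⟨ cong (λ b → ind b * g p) (≡true (≡ᵇ-reflects-≡ p p) refl) ⟩
  g p + 0                         ≡⟨ +-identityʳ (g p) ⟩
  g p                             ∎
  where
  open ≡-Reasoning
  elsewhere : ∀ {k} → 1 ≤ k → k ≤ n → k ≢ p → ind (k ≡ᵇ p) * g k ≡ 0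
  elsewhere {k} _ _ k≢p = cong (λ b → ind b * g k) (≡false (≡ᵇ-reflects-≡ k p) k≢p)

∑-swap-pairs : ∀ n (G : ℕ → ℕ → ℕ → ℕ → ℕ) →
               ∑ n (λ x → ∑ n (λ y → ∑ n (λ b → ∑ n (λ c → G x y b c))))
               ≡ ∑ n (λ b → ∑ n (λ c → ∑ n (λ x → ∑ n (λ y → G x y b c))))
∑-swap-pairs n G =
  trans (∑-cong′ n (λ x → ∑-swap n n (λ y b → ∑ n (G x y b))))
  (trans (∑-swap n n (λ x b → ∑ n (λ y → ∑ n (G x y b))))
  (∑-cong′ n (λ b → trans (∑-cong′ n (λ x → ∑-swap n n (λ y c → G x y b c)))
                          (∑-swap n n (λ x c → ∑ n (λ y → G x y b c))))))

∑-symmetrize : ∀ n (F : ℕ → ℕ → ℕ) → (∀ {b} → 1 ≤ b → b ≤ n → F b b ≡ 0) →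
               ∑ n (λ b → ∑ n (λ c → F b c)) ≡ ∑ n (λ b → ∑ n (λ c → ind (b <ᵇ c) * (F b c + F c b)))
∑-symmetrize n F diagonal = begin
  ∑ n (λ b → ∑ n (λ c → F b c))
    ≡⟨ ∑-cong n (λ 1≤b b≤n → ∑-cong′ n (λ c → split 1≤b b≤n c)) ⟩
  ∑ n (λ b → ∑ n (λ c → upper b c + flipped c b))
    ≡⟨ ∑-distrib-+² upper (λ b c → flipped c b) ⟩
  ∑ n (λ b → ∑ n (λ c → upper b c)) + ∑ n (λ b → ∑ n (λ c → flipped c b))
    ≡⟨ cong (_+_ (∑ n (λ b → ∑ n (λ c → upper b c)))) (∑-swap n n (λ b c → flipped c b)) ⟩
  ∑ n (λ b → ∑ n (λ c → upper b c)) + ∑ n (λ b → ∑ n (λ c → flipped b c))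
    ≡⟨ sym (∑-distrib-+² upper flipped) ⟩
  ∑ n (λ b → ∑ n (λ c → upper b c + flipped b c))
    ≡⟨ ∑-cong′ n (λ b → ∑-cong′ n (λ c → sym (*-distribˡ-+ (ind (b <ᵇ c)) (F b c) (F c b)))) ⟩
  ∑ n (λ b → ∑ n (λ c → ind (b <ᵇ c) * (F b c + F c b))) ∎
  where
  open ≡-Reasoning
  upper flipped : ℕ → ℕ → ℕ
  upper   b c = ind (b <ᵇ c) * F b c
  flipped b c = ind (b <ᵇ c) * F c b
  ∑-distrib-+² : ∀ (G H : ℕ → ℕ → ℕ) →
                 ∑ n (λ b → ∑ n (λ c → G b c + H b c)) ≡ ∑ n (λ b → ∑ n (G b)) + ∑ n (λ b → ∑ n (H b))
  ∑-distrib-+² G H = trans (∑-cong′ n (λ b → ∑-distrib-+ n (G b) (H b))) (∑-distrib-+ n _ _)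
  split : ∀ {b} → 1 ≤ b → b ≤ n → ∀ c → F b c ≡ upper b c + flipped c b
  split {b} 1≤b b≤n c with b <ᵇ c | <ᵇ-reflects-< b c | c <ᵇ b | <ᵇ-reflects-< c b
  ... | true  | ofʸ b<c | true  | ofʸ c<b = contradiction c<b (<⇒≯ b<c)
  ... | true  | _       | false | _       = sym (trans (+-identityʳ _) (+-identityʳ _))
  ... | false | _       | true  | _       = sym (+-identityʳ _)
  ... | false | ofⁿ b≮c | false | ofⁿ c≮b with refl ← ≤-antisym (≮⇒≥ c≮b) (≮⇒≥ b≮c) = diagonal 1≤b b≤n

ind-∧ : ∀ p q → ind (p ∧ q) ≡ ind p * ind q
ind-∧ false q = refl
ind-∧ true  q = sym (+-identityʳ (ind q))

ind-∧-split : ∀ a p q → (q ≡ true → p ≡ true) → ind (a ∧ p) ≡ ind (a ∧ q) + ind (a ∧ (p ∧ not q))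
ind-∧-split false p     q     _   = refl
ind-∧-split true  true  true  _   = refl
ind-∧-split true  true  false _   = refl
ind-∧-split true  false false _   = refl
ind-∧-split true  false true  q⇒p = contradiction (q⇒p refl) λ ()

ind-regroup : ∀ p q r s t k → ind (p ∧ q ∧ r) * (ind (s ∧ t) * k) ≡ ind (p ∧ s) * (ind (q ∧ t) * ind r) * k
ind-regroup p q r s t k
  rewrite ind-∧ p (q ∧ r) | ind-∧ q r | ind-∧ s t | ind-∧ p s | ind-∧ q t =
  regroup (ind p) (ind q) (ind r) (ind s) (ind t) k
  where
  regroup : ∀ p q r s t k → p * (q * r) * (s * t * k) ≡ p * s * (q * t * r) * k
  regroup = solve-∀

ind-<ᵇ-+-ind->ᵇ : ∀ x y → ind (x <ᵇ y) + ind (y <ᵇ x) ≡ ind (not (x ≡ᵇ y))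
ind-<ᵇ-+-ind->ᵇ x y with <-cmp x y
... | tri< x<y x≢y _
  rewrite ≡true (<ᵇ-reflects-< x y) x<y | ≡false (<ᵇ-reflects-< y x) (<⇒≯ x<y)
        | ≡false (≡ᵇ-reflects-≡ x y) x≢y = refl
... | tri≈ x≮x refl _
  rewrite ≡false (<ᵇ-reflects-< x x) x≮x | ≡true (≡ᵇ-reflects-≡ x x) refl = refl
... | tri> _ x≢y y<x
  rewrite ≡false (<ᵇ-reflects-< x y) (<⇒≯ y<x) | ≡true (<ᵇ-reflects-< y x) y<x
        | ≡false (≡ᵇ-reflects-≡ x y) x≢y = refl

ind-≤ᵇ-+-ind-<ᵇ : ∀ a p → ind (a ≤ᵇ p) + ind (p <ᵇ a) ≡ 1
ind-≤ᵇ-+-ind-<ᵇ a p with a ≤? p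
... | yes a≤p rewrite ≡true (≤ᵇ-reflects-≤ a p) a≤p | ≡false (<ᵇ-reflects-< p a) (≤⇒≯ a≤p) = refl
... | no a≰p  rewrite ≡false (≤ᵇ-reflects-≤ a p) a≰p | ≡true (<ᵇ-reflects-< p a) (≰⇒> a≰p) = refl

∑-ind-≤ᵇ-+-∑-ind-<ᵇ : ∀ n p → ∑ n (λ a → ind (a ≤ᵇ p)) + ∑ n (λ a → ind (p <ᵇ a)) ≡ n
∑-ind-≤ᵇ-+-∑-ind-<ᵇ n p =
  trans (sym (∑-distrib-+ n _ _)) (trans (∑-cong′ n (λ a → ind-≤ᵇ-+-ind-<ᵇ a p)) (∑-one n))

countPairs : ℕ → (ℕ → ℕ → Bool) → ℕ
countPairs n P = ∑ n (λ a → ∑ n (λ b → ind ((a <ᵇ b) ∧ P a b)))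

noPairFrom : ∀ (P : ℕ → ℕ → Bool) a {b} → b ≤ a → ind ((a <ᵇ b) ∧ P a b) ≡ 0
noPairFrom P a {b} b≤a = cong (λ x → ind (x ∧ P a b)) (≡false (<ᵇ-reflects-< a b) (≤⇒≯ b≤a))

countPairs-suc : ∀ n P → countPairs (suc n) P ≡ countPairs n P + ∑ n (λ a → ind (P a (suc n)))
countPairs-suc n P = begin
  ∑ n (λ a → ∑ (suc n) (pair a)) + ∑ (suc n) (pair (suc n))
    ≡⟨ cong₂ _+_ (∑-cong n (λ {a} _ a≤n → cong (_+_ (∑ n (pair a))) (newColumn a≤n)))
                 (∑-zero (suc n) (λ _ → noPairFrom P (suc n))) ⟩
  ∑ n (λ a → ∑ n (pair a) + ind (P a (suc n))) + 0
    ≡⟨ trans (+-identityʳ _) (∑-distrib-+ n _ _) ⟩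
  countPairs n P + ∑ n (λ a → ind (P a (suc n))) ∎
  where
  open ≡-Reasoning
  pair : ℕ → ℕ → ℕ
  pair a b = ind ((a <ᵇ b) ∧ P a b)
  newColumn : ∀ {a} → a ≤ n → pair a (suc n) ≡ ind (P a (suc n))
  newColumn {a} a≤n = cong (λ x → ind (x ∧ P a (suc n))) (≡true (<ᵇ-reflects-< a (suc n)) (s≤s a≤n))

countPairs-shift : ∀ N P → countPairs (suc N) P ≡ ∑ N (λ a → ∑ N (λ j → ind ((a <ᵇ suc j) ∧ P a (suc j))))
countPairs-shift N P = begin
  ∑ N (λ a → ∑ (suc N) (pair a)) + ∑ (suc N) (pair (suc N))
    ≡⟨ cong₂ _+_ (∑-cong N (λ {a} 1≤a _ → trans (∑-front N (pair a))
                                                 (cong (_+ ∑ N (pair a ∘ suc)) (firstColumn 1≤a))))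
                 (∑-zero (suc N) (λ _ → noPairFrom P (suc N))) ⟩
  ∑ N (λ a → ∑ N (λ j → pair a (suc j))) + 0
    ≡⟨ +-identityʳ _ ⟩
  ∑ N (λ a → ∑ N (λ j → pair a (suc j))) ∎
  where
  open ≡-Reasoning
  pair : ℕ → ℕ → ℕ
  pair a b = ind ((a <ᵇ b) ∧ P a b)
  firstColumn : ∀ {a} → 1 ≤ a → pair a 1 ≡ 0
  firstColumn 1≤a = noPairFrom P _ 1≤a

tForm : ℕ → ℕ → ℕ → ℕ → ℤ
tForm N m v w = (sumRℤ 1 m (λ i → + N -ℤ + i) -ℤ + v) +ℤ + w

tForm-cong : ∀ {N m m′ v v′ w w′} → m ≡ m′ → v ≡ v′ → w ≡ w′ → tForm N m v w ≡ tForm N m′ v′ w′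
tForm-cong refl refl refl = refl

sumRℤ-shift : ∀ N m → sumRℤ 1 m (λ i → + suc N -ℤ + i) ≡ sumRℤ 1 m (λ i → + N -ℤ + i) +ℤ + m
sumRℤ-shift N zero    = refl
sumRℤ-shift N (suc m) = begin
  sumRℤ 1 (suc m) (λ i → + suc N -ℤ + i)                   ≡⟨ sumRℤ-1-suc m _ ⟩
  sumRℤ 1 m (λ i → + suc N -ℤ + i) +ℤ (+ suc N -ℤ + suc m)  ≡⟨ cong (_+ℤ (+ suc N -ℤ + suc m)) (sumRℤ-shift N m) ⟩
  (σ +ℤ + m) +ℤ (+ suc N -ℤ + suc m)                        ≡⟨ regroup σ (+ m) (+ N) ⟩
  (σ +ℤ (+ N -ℤ + suc m)) +ℤ + suc m                        ≡⟨ cong (_+ℤ + suc m) (sumRℤ-1-suc m _) ⟨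
  sumRℤ 1 (suc m) (λ i → + N -ℤ + i) +ℤ + suc m             ∎
  where
  open ≡-Reasoning
  σ = sumRℤ 1 m (λ i → + N -ℤ + i)
  regroup : ∀ s m n → (s +ℤ m) +ℤ ((+ 1 +ℤ n) -ℤ (+ 1 +ℤ m)) ≡ (s +ℤ (n -ℤ (+ 1 +ℤ m))) +ℤ (+ 1 +ℤ m)
  regroup = ℤ-Solver.solve-∀

tForm-suc : ∀ N m v w → tForm (suc N) m v w ≡ tForm N m v w +ℤ + m
tForm-suc N m v w = trans (cong (λ s → (s -ℤ + v) +ℤ + w) (sumRℤ-shift N m))
                          (regroup (sumRℤ 1 m (λ i → + N -ℤ + i)) (+ m) (+ v) (+ w))
  where
  regroup : ∀ s m v w → ((s +ℤ m) -ℤ v) +ℤ w ≡ ((s -ℤ v) +ℤ w) +ℤ m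
  regroup = ℤ-Solver.solve-∀

tForm-suc-suc : ∀ {N} L S m v w z → N ≡ L + S → tForm (suc N) (suc m) (v + S) (w + z) ≡ tForm N m v w +ℤ + (L + z)
tForm-suc-suc L S m v w z refl =
  trans (cong (λ s → (s -ℤ + (v + S)) +ℤ + (w + z))
              (trans (sumRℤ-1-suc m _) (cong (_+ℤ (+ suc (L + S) -ℤ + suc m)) (sumRℤ-shift (L + S) m))))
        (regroup (sumRℤ 1 m (λ i → + (L + S) -ℤ + i)) (+ m) (+ L) (+ S) (+ v) (+ w) (+ z))
  where
  regroup : ∀ s m L S v w z →
            (((s +ℤ m) +ℤ ((+ 1 +ℤ (L +ℤ S)) -ℤ (+ 1 +ℤ m))) -ℤ (v +ℤ S)) +ℤ (w +ℤ z)
            ≡ ((s -ℤ v) +ℤ w) +ℤ (L +ℤ z)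
  regroup = ℤ-Solver.solve-∀

-- Arcs of a labelling

module _ (A : Labelling) where

  record Arc (k l : ℕ) : Set where
    constructor arc
    field
      positive    : 1 ≤ k
      increasing  : k < l
      sameBlock   : A k ≡ A l
      noneBetween : ∀ {m} → k < m → m < l → A k ≢ A m
  open Arc

  inBlockBetween-reflects : ∀ x a b → Reflects (∃[ m ] a < m × m < b × A x ≡ A m)
                                               (anyR (suc a) (b ∸ 1) (λ m → A x ≡ᵇ A m))
  inBlockBetween-reflects x a b = anyR-between-reflects a b (λ m → ≡ᵇ-reflects-≡ (A x) (A m))

  inBlockBetween? : ∀ x a b → Dec (∃[ m ] a < m × m < b × A x ≡ A m)
  inBlockBetween? x a b = _ because inBlockBetween-reflects x a b

  isArc-reflects : ∀ n k l → Reflects (Arc k l × l ≤ n) (isArc n A k l)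
  isArc-reflects n k l = reflects-map to from
    (≤ᵇ-reflects-≤ 1 k ×-reflects <ᵇ-reflects-< k l ×-reflects ≤ᵇ-reflects-≤ l n ×-reflects
     ≡ᵇ-reflects-≡ (A k) (A l) ×-reflects ¬-reflects (inBlockBetween-reflects k k l))
    where
    to : 1 ≤ k × k < l × l ≤ n × A k ≡ A l × ¬ (∃[ m ] k < m × m < l × A k ≡ A m) → Arc k l × l ≤ n
    to (1≤k , k<l , l≤n , eq , none) = arc 1≤k k<l eq (λ k<m m<l eq′ → none (_ , k<m , m<l , eq′)) , l≤n
    from : Arc k l × l ≤ n → 1 ≤ k × k < l × l ≤ n × A k ≡ A l × ¬ (∃[ m ] k < m × m < l × A k ≡ A m)
    from (α , l≤n) =
      positive α , increasing α , l≤n , sameBlock α , λ (_ , k<m , m<l , eq) → noneBetween α k<m m<l eq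

  arc-target-unique : ∀ {a l l′} → Arc a l → Arc a l′ → l ≡ l′
  arc-target-unique {a} {l} {l′} α β with <-cmp l l′
  ... | tri< l<l′ _ _ = contradiction (sameBlock α) (noneBetween β (increasing α) l<l′)
  ... | tri≈ _ l≡l′ _ = l≡l′
  ... | tri> _ _ l′<l = contradiction (sameBlock β) (noneBetween α (increasing β) l′<l)

  arc-source-unique : ∀ {k k′ b} → Arc k b → Arc k′ b → k ≡ k′
  arc-source-unique {k} {k′} α β with <-cmp k k′
  ... | tri< k<k′ _ _ = contradiction (trans (sameBlock α) (sym (sameBlock β))) (noneBetween α k<k′ (increasing β))
  ... | tri≈ _ k≡k′ _ = k≡k′
  ... | tri> _ _ k′<k = contradiction (trans (sameBlock β) (sym (sameBlock α))) (noneBetween β k′<k (increasing α))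

  arc-from : ∀ {a b} → 1 ≤ a → a < b → A a ≡ A b → ∃[ l ] a < l × l ≤ b × Arc a l
  arc-from {a} 1≤a = go (<-wellFounded _)
    where
    go : ∀ {b} → Acc _<_ b → a < b → A a ≡ A b → ∃[ l ] a < l × l ≤ b × Arc a l
    go {b} (acc rec) a<b eq with inBlockBetween? a a b
    ... | no none = b , a<b , ≤-refl , arc 1≤a a<b eq (λ a<m m<b eq′ → none (_ , a<m , m<b , eq′))
    ... | yes (m , a<m , m<b , eq′) with l , a<l , l≤m , α ← go (rec m<b) a<m eq′ =
          l , a<l , ≤-trans l≤m (<⇒≤ m<b) , α

  arc-into : ∀ {a b} → 1 ≤ a → a < b → A a ≡ A b → ∃[ k ] a ≤ k × k < b × Arc k b
  arc-into {a} {b} = go (<-wellFounded (b ∸ a))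
    where
    go : ∀ {a} → Acc _<_ (b ∸ a) → 1 ≤ a → a < b → A a ≡ A b → ∃[ k ] a ≤ k × k < b × Arc k b
    go {a} (acc rec) 1≤a a<b eq with inBlockBetween? b a b
    ... | no none = a , ≤-refl , a<b , arc 1≤a a<b eq (λ a<m m<b eq′ → none (_ , a<m , m<b , trans (sym eq) eq′))
    ... | yes (m , a<m , m<b , eq′)
        with k , m≤k , k<b , α ← go (rec (∸-monoʳ-< a<m (<⇒≤ m<b))) (≤-trans 1≤a (<⇒≤ a<m)) m<b (sym eq′) =
          k , ≤-trans (<⇒≤ a<m) m≤k , k<b , α

  isArc-suc : ∀ n k {l} → l ≤ n → isArc (suc n) A k l ≡ isArc n A k l
  isArc-suc n k {l} l≤n = det (isArc-reflects (suc n) k l)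
    (reflects-map (λ (α , _) → α , m≤n⇒m≤1+n l≤n) (λ (α , _) → α , l≤n) (isArc-reflects n k l))

  isArc-backward : ∀ n {k l} → l ≤ k → isArc n A k l ≡ false
  isArc-backward n {k} {l} l≤k = ≡false (isArc-reflects n k l) (λ (α , _) → <⇒≱ (increasing α) l≤k)

  NoArcInto : ℕ → Set
  NoArcInto v = ∀ {k} → ¬ Arc k v

  arcInto? : ∀ v → NoArcInto v ⊎ ∃[ p ] Arc p v
  arcInto? v with inBlockBetween? v 0 v
  ... | no none = inj₁ (λ α → none (_ , positive α , increasing α , sym (sameBlock α)))
  ... | yes (m , 0<m , m<v , eq) with p , _ , _ , α ← arc-into 0<m m<v (sym eq) = inj₂ (p , α)

  countArcs-∑ : ∀ n P → countArcs n A P ≡ ∑ n (λ k → ∑ n (λ l → ind (isArc n A k l ∧ P k l)))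
  countArcs-∑ n P = trans (sumR-1≡∑ n _) (∑-cong′ n (λ k → sumR-1≡∑ n _))

  countArcs-zero : ∀ n P → (∀ {k l} → Arc k l → l ≤ n → P k l ≡ false) → countArcs n A P ≡ 0
  countArcs-zero n P none = trans (countArcs-∑ n P) (∑-zero n (λ {k} _ _ → ∑-zero n (λ {l} _ _ → term k l)))
    where
    term : ∀ k l → ind (isArc n A k l ∧ P k l) ≡ 0
    term k l with isArc n A k l | isArc-reflects n k l
    ... | false | _             = refl
    ... | true  | ofʸ (α , l≤n) = cong ind (none α l≤n)

  countArcs-pos : ∀ n P {k l} → Arc k l → l ≤ n → P k l ≡ true → 0 < countArcs n A P
  countArcs-pos n P {k} {l} α l≤n holds = begin
    1
      ≡⟨ cong₂ (λ x y → ind (x ∧ y)) (≡true (isArc-reflects n k l) (α , l≤n)) holds ⟨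
    ind (isArc n A k l ∧ P k l)
      ≤⟨ term≤∑ n _ (<-≤-trans z<s k<l) l≤n ⟩
    ∑ n (λ l → ind (isArc n A k l ∧ P k l))
      ≤⟨ term≤∑ n _ (positive α) (<⇒≤ (<-≤-trans k<l l≤n)) ⟩
    ∑ n (λ k → ∑ n (λ l → ind (isArc n A k l ∧ P k l)))
      ≡⟨ countArcs-∑ n P ⟨
    countArcs n A P ∎
    where
    open ≤-Reasoning
    k<l = increasing α

  countArcs-split : ∀ n P Q → (∀ k l → Q k l ≡ true → P k l ≡ true) →
                    countArcs n A P ≡ countArcs n A Q + countArcs n A (λ k l → P k l ∧ not (Q k l))
  countArcs-split n P Q Q⇒P =
    trans (countArcs-∑ n P)
    (trans (∑-cong′ n (λ k → trans (∑-cong′ n (λ l → ind-∧-split (isArc n A k l) (P k l) (Q k l) (Q⇒P k l)))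
                                   (∑-distrib-+ n _ _)))
    (trans (∑-distrib-+ n _ _)
           (sym (cong₂ _+_ (countArcs-∑ n Q) (countArcs-∑ n _)))))

  newArcs : ℕ → (ℕ → ℕ → Bool) → ℕ
  newArcs n P = ∑ n (λ k → ind (isArc (suc n) A k (suc n) ∧ P k (suc n)))

  countArcs-suc : ∀ n P → countArcs (suc n) A P ≡ countArcs n A P + newArcs n P
  countArcs-suc n P = begin
    countArcs (suc n) A P
      ≡⟨ countArcs-∑ (suc n) P ⟩
    ∑ n (λ k → ∑ n (entry k) + entry k (suc n)) + ∑ (suc n) (entry (suc n))
      ≡⟨ cong (_+_ (∑ n (λ k → ∑ n (entry k) + entry k (suc n)))) (∑-zero (suc n) lastRow) ⟩
    ∑ n (λ k → ∑ n (entry k) + entry k (suc n)) + 0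
      ≡⟨ trans (+-identityʳ _) (∑-distrib-+ n _ _) ⟩
    ∑ n (λ k → ∑ n (entry k)) + newArcs n P
      ≡⟨ cong (_+ newArcs n P)
              (trans (∑-cong′ n (λ k → ∑-cong n (λ {l} _ l≤n → cong (λ b → ind (b ∧ P k l)) (isArc-suc n k l≤n))))
                     (sym (countArcs-∑ n P))) ⟩
    countArcs n A P + newArcs n P ∎
    where
    open ≡-Reasoning
    entry : ℕ → ℕ → ℕ
    entry k l = ind (isArc (suc n) A k l ∧ P k l)
    lastRow : ∀ {l} → 1 ≤ l → l ≤ suc n → entry (suc n) l ≡ 0
    lastRow {l} _ l≤1+n = cong (λ b → ind (b ∧ P (suc n) l)) (isArc-backward (suc n) l≤1+n)

  newArcs-noArcInto : ∀ n P → NoArcInto (suc n) → newArcs n P ≡ 0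
  newArcs-noArcInto n P none = ∑-zero n λ {k} _ _ →
    cong (λ b → ind (b ∧ P k (suc n))) (≡false (isArc-reflects (suc n) k (suc n)) (none ∘ proj₁))

  newArcs-arcInto : ∀ n P {p} → Arc p (suc n) → newArcs n P ≡ ind (P p (suc n))
  newArcs-arcInto n P {p} α =
    trans (∑-single n p (positive α) (s≤s⁻¹ (increasing α)) others)
          (cong (λ b → ind (b ∧ P p (suc n))) (≡true (isArc-reflects (suc n) p (suc n)) (α , ≤-refl)))
    where
    others : ∀ {k} → 1 ≤ k → k ≤ n → k ≢ p → ind (isArc (suc n) A k (suc n) ∧ P k (suc n)) ≡ 0
    others {k} _ _ k≢p = cong (λ b → ind (b ∧ P k (suc n)))
      (≡false (isArc-reflects (suc n) k (suc n)) (λ (β , _) → k≢p (arc-source-unique β α)))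

  outdeg : ℕ → ℕ → ℕ
  outdeg n a = ∑ n (λ l → ind (isArc n A a l))

  numArcs-outdeg : ∀ n → numArcs n A ≡ ∑ n (outdeg n)
  numArcs-outdeg n = trans (countArcs-∑ n _) (∑-cong′ n (λ a → ∑-cong′ n (λ l → cong ind (∧-identityʳ _))))

  outdeg-arc : ∀ n {a l} → Arc a l → l ≤ n → outdeg n a ≡ 1
  outdeg-arc n {a} {l} α l≤n =
    trans (∑-single n l (≤-trans (positive α) (<⇒≤ (increasing α))) l≤n others)
          (cong ind (≡true (isArc-reflects n a l) (α , l≤n)))
    where
    others : ∀ {l′} → 1 ≤ l′ → l′ ≤ n → l′ ≢ l → ind (isArc n A a l′) ≡ 0
    others {l′} _ _ l′≢l = cong ind (≡false (isArc-reflects n a l′) (λ (β , _) → l′≢l (arc-target-unique β α)))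

  outdeg-none : ∀ n {a} → (∀ {l} → Arc a l → ¬ l ≤ n) → outdeg n a ≡ 0
  outdeg-none n {a} none = ∑-zero n λ {l} _ _ → cong ind (≡false (isArc-reflects n a l) (λ (α , l≤n) → none α l≤n))

  -- Boundary arcs and the rank control matrix

  BoundaryArc : ℕ → ℕ → Set
  BoundaryArc a b = (∃[ l ] a < l × l ≤ b × Arc a l) ⊎ (∃[ k ] a ≤ k × k < b × Arc k b)

  boundaryArc : ℕ → ℕ → Bool
  boundaryArc a b = anyR (suc a) b (λ l → isArc b A a l) ∨ anyR a (b ∸ 1) (λ k → isArc b A k b)

  boundaryArc-reflects : ∀ a b → Reflects (BoundaryArc a b) (boundaryArc a b)
  boundaryArc-reflects a b =
    reflects-map (λ (l , a<l , l≤b , α , _) → l , a<l , l≤b , α)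
                 (λ (l , a<l , l≤b , α) → l , a<l , l≤b , α , l≤b)
                 (anyR-reflects (suc a) b (λ l → isArc-reflects b a l))
    ⊎-reflects
    reflects-map (λ (k , a≤k , k≤b-1 , α , _) → k , a≤k , ≤∸1⇒< (positive α) k≤b-1 , α)
                 (λ (k , a≤k , k<b , α) → k , a≤k , <⇒≤∸1 k<b , α , ≤-refl)
                 (anyR-reflects a (b ∸ 1) (λ k → isArc-reflects b k b))

  boundaryArc⇒< : ∀ {a b} → BoundaryArc a b → a < b
  boundaryArc⇒< (inj₁ (l , a<l , l≤b , _)) = <-≤-trans a<l l≤b
  boundaryArc⇒< (inj₂ (k , a≤k , k<b , _)) = ≤-<-trans a≤k k<b

  rank-step : ∀ n a j → suc j ≤ n → (r n A (suc a) j ≡ᵇ r n A a (suc j)) ≡ not (boundaryArc a (suc j))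
  rank-step n a j j<n = begin
    r n A (suc a) j ≡ᵇ r n A a (suc j)
      ≡⟨ cong (r n A (suc a) j ≡ᵇ_) (countArcs-split n P Q Q⇒P) ⟩
    r n A (suc a) j ≡ᵇ r n A (suc a) j + X
      ≡⟨ m≡ᵇm+n≡n≡ᵇ0 (r n A (suc a) j) X ⟩
    X ≡ᵇ 0
      ≡⟨ det (≡ᵇ0-reflects-¬ X hit miss) (¬-reflects (boundaryArc-reflects a (suc j))) ⟩
    not (boundaryArc a (suc j)) ∎
    where
    open ≡-Reasoning
    P Q : ℕ → ℕ → Bool
    P k l = (a ≤ᵇ k) ∧ (l ≤ᵇ suc j)
    Q k l = (suc a ≤ᵇ k) ∧ (l ≤ᵇ j)
    X = countArcs n A (λ k l → P k l ∧ not (Q k l))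
    Q⇒P : ∀ k l → Q k l ≡ true → P k l ≡ true
    Q⇒P k l eq with (a<k , l≤j) ← witness (≤ᵇ-reflects-≤ (suc a) k ×-reflects ≤ᵇ-reflects-≤ l j) eq =
      ≡true (≤ᵇ-reflects-≤ a k ×-reflects ≤ᵇ-reflects-≤ l (suc j)) (<⇒≤ a<k , m≤n⇒m≤1+n l≤j)
    touches : ∀ k l → Reflects ((a ≤ k × l ≤ suc j) × ¬ (a < k × l ≤ j)) (P k l ∧ not (Q k l))
    touches k l = (≤ᵇ-reflects-≤ a k ×-reflects ≤ᵇ-reflects-≤ l (suc j)) ×-reflects
                  ¬-reflects (≤ᵇ-reflects-≤ (suc a) k ×-reflects ≤ᵇ-reflects-≤ l j)
    hit : BoundaryArc a (suc j) → 0 < X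
    hit (inj₁ (l , a<l , l≤b , α)) =
      countArcs-pos n _ α (≤-trans l≤b j<n) (≡true (touches a l) ((≤-refl , l≤b) , λ (a<a , _) → <-irrefl refl a<a))
    hit (inj₂ (k , a≤k , k<b , α)) =
      countArcs-pos n _ α j<n (≡true (touches k (suc j)) ((a≤k , ≤-refl) , λ (_ , b≤j) → 1+n≰n b≤j))
    miss : ¬ BoundaryArc a (suc j) → X ≡ 0
    miss ¬boundary = countArcs-zero n _ λ {k} {l} α _ → ≡false (touches k l) (inner α)
      where
      inner : ∀ {k l} → Arc k l → ¬ ((a ≤ k × l ≤ suc j) × ¬ (a < k × l ≤ j))
      inner {k} {l} α ((a≤k , l≤b) , notInner) with m≤n⇒m<n∨m≡n a≤k | m≤n⇒m<n∨m≡n l≤b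
      ... | inj₂ refl | _         = ¬boundary (inj₁ (l , increasing α , l≤b , α))
      ... | inj₁ _    | inj₂ refl = ¬boundary (inj₂ (k , a≤k , increasing α , α))
      ... | inj₁ a<k  | inj₁ l<b  = notInner (a<k , s≤s⁻¹ l<b)

  <ᵇ∧boundaryArc : ∀ a b → (a <ᵇ b) ∧ boundaryArc a b ≡ boundaryArc a b
  <ᵇ∧boundaryArc a b = det (<ᵇ-reflects-< a b ×-reflects boundaryArc-reflects a b)
                           (reflects-map (λ β → boundaryArc⇒< β , β) proj₂ (boundaryArc-reflects a b))

  -- The entry (i, j) of D and of E is the pair (i − 1, j + 1).
  DStat≡countPairs : ∀ n → DStat n A ≡ countPairs n boundaryArc
  DStat≡countPairs zero    = refl
  DStat≡countPairs (suc N) = begin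
    DStat (suc N) A
      ≡⟨ trans (sumR-2≡∑ (suc N) _) (∑-cong′ N (λ a → sumR-1≡∑ N _)) ⟩
    ∑ N (λ a → ∑ N (λ j → ind (not (r (suc N) A (suc a) j ≡ᵇ r (suc N) A a (suc j)))))
      ≡⟨ ∑-cong′ N (λ a → ∑-cong N (λ _ j≤N → cong ind (entry a j≤N))) ⟩
    ∑ N (λ a → ∑ N (λ j → ind ((a <ᵇ suc j) ∧ boundaryArc a (suc j))))
      ≡⟨ sym (countPairs-shift N boundaryArc) ⟩
    countPairs (suc N) boundaryArc ∎
    where
    open ≡-Reasoning
    entry : ∀ a {j} → j ≤ N →
            not (r (suc N) A (suc a) j ≡ᵇ r (suc N) A a (suc j)) ≡ (a <ᵇ suc j) ∧ boundaryArc a (suc j)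
    entry a {j} j≤N = trans (cong not (rank-step (suc N) a j (s≤s j≤N)))
                            (trans (not-involutive _) (sym (<ᵇ∧boundaryArc a (suc j))))

  EStat≡countPairs : ∀ n → EStat n A ≡ countPairs n (λ a b → not (boundaryArc a b))
  EStat≡countPairs zero    = refl
  EStat≡countPairs (suc N) = begin
    EStat (suc N) A
      ≡⟨ trans (sumR-2≡∑ (suc N) _) (∑-cong′ N (λ a → sumR-1≡∑ (suc N) _)) ⟩
    ∑ N (λ a → ∑ (suc N) (entry a))
      ≡⟨ ∑-cong′ N (λ a → trans (cong₂ _+_ (∑-cong N (λ _ j≤N → cong ind (inner a j≤N))) (lastEntry a))
                                (+-identityʳ _)) ⟩
    ∑ N (λ a → ∑ N (λ j → ind ((a <ᵇ suc j) ∧ not (boundaryArc a (suc j)))))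
      ≡⟨ sym (countPairs-shift N _) ⟩
    countPairs (suc N) (λ a b → not (boundaryArc a b)) ∎
    where
    open ≡-Reasoning
    entry : ℕ → ℕ → ℕ
    entry a j = ind ((a <ᵇ suc j) ∧ (suc j ≤ᵇ suc N) ∧ (r (suc N) A (suc a) j ≡ᵇ r (suc N) A a (suc j)))
    inner : ∀ a {j} → j ≤ N →
            (a <ᵇ suc j) ∧ (suc j ≤ᵇ suc N) ∧ (r (suc N) A (suc a) j ≡ᵇ r (suc N) A a (suc j))
            ≡ (a <ᵇ suc j) ∧ not (boundaryArc a (suc j))
    inner a {j} j≤N = cong₂ (λ x y → (a <ᵇ suc j) ∧ x ∧ y) (≡true (≤ᵇ-reflects-≤ (suc j) (suc N)) (s≤s j≤N))
                            (rank-step (suc N) a j (s≤s j≤N))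
    lastEntry : ∀ a → entry a (suc N) ≡ 0
    lastEntry a = cong ind (≡false (T-reflects (a <ᵇ suc (suc N)) ×-reflects
                                    ≤ᵇ-reflects-≤ (suc (suc N)) (suc N) ×-reflects T-reflects _)
                                   (λ (_ , past , _) → 1+n≰n past))

  -- Block minima and intertwining

  IsBlockMin : ℕ → ℕ → Set
  IsBlockMin x b = ¬ (∃[ y ] 0 < y × y < x × A x ≡ A y) × A x ≡ A b

  isBlockMin-reflects : ∀ n x b → Reflects (IsBlockMin x b) (isMin n A x ∧ same n A x b)
  isBlockMin-reflects n x b =
    ¬-reflects (inBlockBetween-reflects x 0 x) ×-reflects ≡ᵇ-reflects-≡ (A x) (A b)

  blockMin-exists : ∀ {b} → 1 ≤ b → ∃[ x ] 1 ≤ x × x ≤ b × IsBlockMin x b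
  blockMin-exists {b} = go (<-wellFounded b)
    where
    go : ∀ {b} → Acc _<_ b → 1 ≤ b → ∃[ x ] 1 ≤ x × x ≤ b × IsBlockMin x b
    go {b} (acc rec) 1≤b with inBlockBetween? b 0 b
    ... | no none = b , 1≤b , ≤-refl , none , refl
    ... | yes (y , 0<y , y<b , eq) with x , 1≤x , x≤y , least , eq′ ← go (rec y<b) 0<y =
          x , 1≤x , ≤-trans x≤y (<⇒≤ y<b) , least , trans eq′ (sym eq)

  blockMin-unique : ∀ {x x′ b} → 1 ≤ x → 1 ≤ x′ → IsBlockMin x b → IsBlockMin x′ b → x ≡ x′
  blockMin-unique {x} {x′} 1≤x 1≤x′ (least , eq) (least′ , eq′) with <-cmp x x′
  ... | tri< x<x′ _ _ = contradiction (_ , 1≤x , x<x′ , trans eq′ (sym eq)) least′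
  ... | tri≈ _ x≡x′ _ = x≡x′
  ... | tri> _ _ x′<x = contradiction (_ , 1≤x′ , x′<x , trans eq (sym eq′)) least

  same-reflects : ∀ n x y → Reflects (A x ≡ A y) (same n A x y)
  same-reflects n x y = ≡ᵇ-reflects-≡ (A x) (A y)

  -- The local noBetween of intertw, with the labels of x and y abstracted, so that
  -- intertw-∑ holds by unfolding.
  clearOf : ℕ → ℕ → ℕ → ℕ → Bool
  clearOf α β b c =
    if b <ᵇ c then not (anyR (suc b) (c ∸ 1) (λ k → (α ≡ᵇ A k) ∨ (β ≡ᵇ A k)))
              else not (anyR (suc c) (b ∸ 1) (λ k → (α ≡ᵇ A k) ∨ (β ≡ᵇ A k)))

  separated : ℕ → ℕ → Bool
  separated b c = clearOf (A b) (A c) b c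

  separated-comm : ∀ {b c} → b < c → separated c b ≡ separated b c
  separated-comm {b} {c} b<c
    rewrite ≡false (<ᵇ-reflects-< c b) (<⇒≯ b<c) | ≡true (<ᵇ-reflects-< b c) b<c =
    cong not (anyR-cong (suc b) (c ∸ 1) (λ k → ∨-comm (A c ≡ᵇ A k) (A b ≡ᵇ A k)))

  separated∧distinct : ∀ {b c} → 1 ≤ b → b < c → separated b c ∧ not (A b ≡ᵇ A c) ≡ not (boundaryArc b c)
  separated∧distinct {b} {c} 1≤b b<c rewrite ≡true (<ᵇ-reflects-< b c) b<c =
    det (¬-reflects (anyR-between-reflects b c λ k → ≡ᵇ-reflects-≡ (A b) (A k) ⊎-reflects ≡ᵇ-reflects-≡ (A c) (A k))
         ×-reflects ¬-reflects (≡ᵇ-reflects-≡ (A b) (A c)))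
        (reflects-map to from (¬-reflects (boundaryArc-reflects b c)))
    where
    Clear = ¬ (∃[ k ] b < k × k < c × (A b ≡ A k ⊎ A c ≡ A k))
    to : ¬ BoundaryArc b c → Clear × A b ≢ A c
    to ¬β = (λ { (k , b<k , k<c , inj₁ eq) →
                   let l , b<l , l≤k , α = arc-from 1≤b b<k eq
                   in ¬β (inj₁ (l , b<l , ≤-trans l≤k (<⇒≤ k<c) , α))
               ; (k , b<k , k<c , inj₂ eq) →
                   let k′ , k≤k′ , k′<c , α = arc-into (<-≤-trans z<s b<k) k<c (sym eq)
                   in ¬β (inj₂ (k′ , ≤-trans (<⇒≤ b<k) k≤k′ , k′<c , α)) })
          , λ eq → ¬β (inj₁ (arc-from 1≤b b<c eq))
    from : Clear × A b ≢ A c → ¬ BoundaryArc b c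
    from (clear , distinct) (inj₁ (l , b<l , l≤c , α)) with m≤n⇒m<n∨m≡n l≤c
    ... | inj₁ l<c  = clear (l , b<l , l<c , inj₁ (sameBlock α))
    ... | inj₂ refl = distinct (sameBlock α)
    from (clear , distinct) (inj₂ (k , b≤k , k<c , α)) with m≤n⇒m<n∨m≡n b≤k
    ... | inj₁ b<k  = clear (k , b<k , k<c , inj₂ (sym (sameBlock α)))
    ... | inj₂ refl = distinct (sameBlock α)

  intertw-∑ : ∀ n x y →
              intertw n A x y ≡ ∑ n (λ b → ∑ n (λ c → ind (same n A x b ∧ same n A y c) * ind (separated b c)))
  intertw-∑ n x y = trans (sumR-1≡∑ n _) (∑-cong′ n row)
    where
    row : ∀ b → ind (same n A x b) * countR 1 n (λ c → same n A y c ∧ clearOf (A x) (A y) b c)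
              ≡ ∑ n (λ c → ind (same n A x b ∧ same n A y c) * ind (separated b c))
    row b with same n A x b | same-reflects n x b
    ... | false | _        = sym (∑-zero n (λ _ _ → refl))
    ... | true  | ofʸ x~b = trans (+-identityʳ _) (trans (sumR-1≡∑ n _) (∑-cong′ n entry))
      where
      entry : ∀ c → ind (same n A y c ∧ clearOf (A x) (A y) b c) ≡ ind (same n A y c) * ind (separated b c)
      entry c with same n A y c | same-reflects n y c
      ... | false | _       = refl
      ... | true  | ofʸ y~c = trans (cong₂ (λ α β → ind (clearOf α β b c)) x~b y~c) (sym (+-identityʳ _))

  leads : ℕ → ℕ → ℕ → ℕ
  leads n x b = ind (isMin n A x ∧ same n A x b)

  blockOrder : ℕ → ℕ → ℕ → ℕ
  blockOrder n b c = ∑ n (λ x → ∑ n (λ y → leads n x b * (leads n y c * ind (x <ᵇ y))))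

  iStat-∑ : ∀ n → iStat n A ≡ ∑ n (λ b → ∑ n (λ c → blockOrder n b c * ind (separated b c)))
  iStat-∑ n = begin
    iStat n A
      ≡⟨ trans (sumR-1≡∑ n _) (∑-cong′ n λ x → trans (sumR-1≡∑ n _)
                                                     (∑-cong′ n λ y → cong (_*_ (W x y)) (intertw-∑ n x y))) ⟩
    ∑ n (λ x → ∑ n (λ y → W x y * ∑ n (λ b → ∑ n (λ c → ind (same n A x b ∧ same n A y c) * K b c))))
      ≡⟨ ∑-cong′ n (λ x → ∑-cong′ n (λ y → sym (trans (∑-cong′ n (λ b → ∑-distribˡ-* n (W x y) _))
                                                          (∑-distribˡ-* n (W x y) _)))) ⟩
    ∑ n (λ x → ∑ n (λ y → ∑ n (λ b → ∑ n (λ c → W x y * (ind (same n A x b ∧ same n A y c) * K b c)))))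
      ≡⟨ ∑-cong′ n (λ x → ∑-cong′ n (λ y → ∑-cong′ n (λ b → ∑-cong′ n (λ c →
           ind-regroup (isMin n A x) (isMin n A y) (x <ᵇ y) (same n A x b) (same n A y c) (K b c))))) ⟩
    ∑ n (λ x → ∑ n (λ y → ∑ n (λ b → ∑ n (λ c → leads n x b * (leads n y c * ind (x <ᵇ y)) * K b c))))
      ≡⟨ ∑-swap-pairs n (λ x y b c → leads n x b * (leads n y c * ind (x <ᵇ y)) * K b c) ⟩
    ∑ n (λ b → ∑ n (λ c → ∑ n (λ x → ∑ n (λ y → leads n x b * (leads n y c * ind (x <ᵇ y)) * K b c))))
      ≡⟨ ∑-cong′ n (λ b → ∑-cong′ n (λ c → trans (∑-cong′ n (λ x → ∑-distribʳ-* n (K b c) _))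
                                                 (∑-distribʳ-* n (K b c) _))) ⟩
    ∑ n (λ b → ∑ n (λ c → blockOrder n b c * K b c)) ∎
    where
    open ≡-Reasoning
    W : ℕ → ℕ → ℕ
    W x y = ind (isMin n A x ∧ isMin n A y ∧ (x <ᵇ y))
    K : ℕ → ℕ → ℕ
    K b c = ind (separated b c)

  leads-blockMin : ∀ n {x x₀ b} → 1 ≤ x → 1 ≤ x₀ → IsBlockMin x₀ b → leads n x b ≡ ind (x ≡ᵇ x₀)
  leads-blockMin n {x} {x₀} {b} 1≤x 1≤x₀ least = cong ind (det (isBlockMin-reflects n x b)
    (reflects-map (λ { refl → least }) (λ least′ → blockMin-unique 1≤x 1≤x₀ least′ least) (≡ᵇ-reflects-≡ x x₀)))

  blockOrder-eval : ∀ n {b c x₀ y₀} → 1 ≤ x₀ → x₀ ≤ n → IsBlockMin x₀ b → 1 ≤ y₀ → y₀ ≤ n → IsBlockMin y₀ c →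
                    blockOrder n b c ≡ ind (x₀ <ᵇ y₀)
  blockOrder-eval n {b} {c} {x₀} {y₀} 1≤x₀ x₀≤n lx 1≤y₀ y₀≤n ly = begin
    ∑ n (λ x → ∑ n (λ y → leads n x b * (leads n y c * ind (x <ᵇ y))))
      ≡⟨ ∑-cong′ n (λ x → ∑-distribˡ-* n (leads n x b) _) ⟩
    ∑ n (λ x → leads n x b * ∑ n (λ y → leads n y c * ind (x <ᵇ y)))
      ≡⟨ ∑-cong n (λ 1≤x _ → cong₂ _*_ (leads-blockMin n 1≤x 1≤x₀ lx)
                                       (∑-cong n (λ 1≤y _ → cong (λ l → l * _) (leads-blockMin n 1≤y 1≤y₀ ly)))) ⟩
    ∑ n (λ x → ind (x ≡ᵇ x₀) * ∑ n (λ y → ind (y ≡ᵇ y₀) * ind (x <ᵇ y)))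
      ≡⟨ ∑-select n x₀ _ 1≤x₀ x₀≤n ⟩
    ∑ n (λ y → ind (y ≡ᵇ y₀) * ind (x₀ <ᵇ y))
      ≡⟨ ∑-select n y₀ _ 1≤y₀ y₀≤n ⟩
    ind (x₀ <ᵇ y₀) ∎
    where open ≡-Reasoning

  blockOrder-trichotomy : ∀ n {b c} → 1 ≤ b → b ≤ n → 1 ≤ c → c ≤ n →
                          blockOrder n b c + blockOrder n c b ≡ ind (not (A b ≡ᵇ A c))
  blockOrder-trichotomy n {b} {c} 1≤b b≤n 1≤c c≤n
    with x₀ , 1≤x₀ , x₀≤b , lx ← blockMin-exists 1≤b | y₀ , 1≤y₀ , y₀≤c , ly ← blockMin-exists 1≤c = begin
    blockOrder n b c + blockOrder n c b
      ≡⟨ cong₂ _+_ (blockOrder-eval n 1≤x₀ x₀≤n lx 1≤y₀ y₀≤n ly) (blockOrder-eval n 1≤y₀ y₀≤n ly 1≤x₀ x₀≤n lx) ⟩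
    ind (x₀ <ᵇ y₀) + ind (y₀ <ᵇ x₀)
      ≡⟨ ind-<ᵇ-+-ind->ᵇ x₀ y₀ ⟩
    ind (not (x₀ ≡ᵇ y₀))
      ≡⟨ cong (λ e → ind (not e)) (det (≡ᵇ-reflects-≡ x₀ y₀) (reflects-map to from (≡ᵇ-reflects-≡ (A b) (A c)))) ⟩
    ind (not (A b ≡ᵇ A c)) ∎
    where
    open ≡-Reasoning
    x₀≤n = ≤-trans x₀≤b b≤n
    y₀≤n = ≤-trans y₀≤c c≤n
    to : A b ≡ A c → x₀ ≡ y₀
    to eq = blockMin-unique 1≤x₀ 1≤y₀ lx (proj₁ ly , trans (proj₂ ly) (sym eq))
    from : x₀ ≡ y₀ → A b ≡ A c
    from refl = trans (sym (proj₂ lx)) (proj₂ ly)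

  blockOrder-diagonal : ∀ n {b} → 1 ≤ b → b ≤ n → blockOrder n b b ≡ 0
  blockOrder-diagonal n {b} 1≤b b≤n = m+n≡0⇒m≡0 (blockOrder n b b)
    (trans (blockOrder-trichotomy n 1≤b b≤n 1≤b b≤n)
           (cong (λ e → ind (not e)) (≡true (≡ᵇ-reflects-≡ (A b) (A b)) refl)))

  iStat≡countPairs : ∀ n → iStat n A ≡ countPairs n (λ b c → not (boundaryArc b c))
  iStat≡countPairs n = begin
    iStat n A
      ≡⟨ iStat-∑ n ⟩
    ∑ n (λ b → ∑ n (λ c → Φ b c * K b c))
      ≡⟨ ∑-symmetrize n (λ b c → Φ b c * K b c) (λ 1≤b b≤n → cong (_* _) (blockOrder-diagonal n 1≤b b≤n)) ⟩
    ∑ n (λ b → ∑ n (λ c → ind (b <ᵇ c) * (Φ b c * K b c + Φ c b * K c b)))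
      ≡⟨ ∑-cong n (λ 1≤b b≤n → ∑-cong n (λ 1≤c c≤n → unordered 1≤b b≤n 1≤c c≤n)) ⟩
    countPairs n (λ b c → not (boundaryArc b c)) ∎
    where
    open ≡-Reasoning
    Φ K : ℕ → ℕ → ℕ
    Φ = blockOrder n
    K b c = ind (separated b c)
    unordered : ∀ {b c} → 1 ≤ b → b ≤ n → 1 ≤ c → c ≤ n →
                ind (b <ᵇ c) * (Φ b c * K b c + Φ c b * K c b) ≡ ind ((b <ᵇ c) ∧ not (boundaryArc b c))
    unordered {b} {c} 1≤b b≤n 1≤c c≤n with b <? c
    ... | no b≮c rewrite ≡false (<ᵇ-reflects-< b c) b≮c = refl
    ... | yes b<c = begin
      ind (b <ᵇ c) * (Φ b c * K b c + Φ c b * K c b)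
        ≡⟨ cong (λ x → ind x * (Φ b c * K b c + Φ c b * K c b)) (≡true (<ᵇ-reflects-< b c) b<c) ⟩
      1 * (Φ b c * K b c + Φ c b * K c b)         ≡⟨ *-identityˡ _ ⟩
      Φ b c * K b c + Φ c b * K c b               ≡⟨ cong (λ s → Φ b c * K b c + Φ c b * ind s) (separated-comm b<c) ⟩
      Φ b c * K b c + Φ c b * K b c               ≡⟨ sym (*-distribʳ-+ (K b c) (Φ b c) (Φ c b)) ⟩
      (Φ b c + Φ c b) * K b c                     ≡⟨ cong (_* K b c) (blockOrder-trichotomy n 1≤b b≤n 1≤c c≤n) ⟩
      ind (not (A b ≡ᵇ A c)) * K b c              ≡⟨ *-comm (ind (not (A b ≡ᵇ A c))) (K b c) ⟩
      K b c * ind (not (A b ≡ᵇ A c))              ≡⟨ sym (ind-∧ (separated b c) _) ⟩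
      ind (separated b c ∧ not (A b ≡ᵇ A c))      ≡⟨ cong ind (separated∧distinct 1≤b b<c) ⟩
      ind (not (boundaryArc b c))
        ≡⟨ cong (λ x → ind (x ∧ not (boundaryArc b c))) (≡true (<ᵇ-reflects-< b c) b<c) ⟨
      ind ((b <ᵇ c) ∧ not (boundaryArc b c))      ∎

  -- Adding the vertex n + 1

  boundaryArc-suc-noArcInto : ∀ n a → (∀ {k} → a ≤ k → ¬ Arc k (suc n)) →
                              ind (boundaryArc a (suc n)) ≡ outdeg n a
  boundaryArc-suc-noArcInto n a noneInto with boundaryArc a (suc n) | boundaryArc-reflects a (suc n)
  ... | false | ofⁿ ¬β = sym (outdeg-none n (λ α l≤n → ¬β (inj₁ (_ , increasing α , m≤n⇒m≤1+n l≤n , α))))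
  ... | true  | ofʸ (inj₂ (k , a≤k , _ , α)) = contradiction α (noneInto a≤k)
  ... | true  | ofʸ (inj₁ (l , a<l , l≤1+n , α)) with m≤n⇒m<n∨m≡n l≤1+n
  ...   | inj₁ l<1+n = sym (outdeg-arc n α (s≤s⁻¹ l<1+n))
  ...   | inj₂ refl  = contradiction α (noneInto ≤-refl)

  boundaryArc-suc-arcInto : ∀ n a {p} → Arc p (suc n) →
                          ind (boundaryArc a (suc n)) ≡ ind (a ≤ᵇ p) + ind (p <ᵇ a) * outdeg n a
  boundaryArc-suc-arcInto n a {p} α with a ≤? p
  ... | yes a≤p rewrite ≡true (≤ᵇ-reflects-≤ a p) a≤p | ≡false (<ᵇ-reflects-< p a) (≤⇒≯ a≤p) =
    cong ind (≡true (boundaryArc-reflects a (suc n)) (inj₂ (p , a≤p , increasing α , α)))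
  ... | no a≰p rewrite ≡false (≤ᵇ-reflects-≤ a p) a≰p | ≡true (<ᵇ-reflects-< p a) (≰⇒> a≰p) =
    trans (boundaryArc-suc-noArcInto n a onlyFromP) (sym (+-identityʳ _))
    where
    onlyFromP : ∀ {k} → a ≤ k → ¬ Arc k (suc n)
    onlyFromP a≤k β = a≰p (subst (a ≤_) (arc-source-unique β α) a≤k)

  vertexDepth arcDepth : ℕ → ℕ
  vertexDepth n = ∑ n (depthV n A)
  arcDepth    n = ∑ n (λ u → ∑ n (λ v → ind (isArc n A u v) * depthArc n A u v))

  tStat-tForm : ∀ n → tStat n A ≡ tForm n (numArcs n A) (vertexDepth n) (arcDepth n)
  tStat-tForm n = cong₂ (λ v w → (sumRℤ 1 (numArcs n A) (λ i → + n -ℤ + i) -ℤ + v) +ℤ + w)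
                        (sumR-1≡∑ n _) (trans (sumR-1≡∑ n _) (∑-cong′ n (λ u → sumR-1≡∑ n _)))

  around : ℕ → ℕ → ℕ → ℕ → Bool
  around u v i j = (i <ᵇ u) ∧ (v <ᵇ j)

  countArcs-around-last : ∀ n u → countArcs (suc n) A (around u (suc n)) ≡ 0
  countArcs-around-last n u = countArcs-zero (suc n) _ λ {k} {l} _ l≤1+n →
    ≡false (T-reflects (k <ᵇ u) ×-reflects <ᵇ-reflects-< (suc n) l) (λ (_ , 1+n<l) → <⇒≱ 1+n<l l≤1+n)

  vertexDepth-suc : ∀ n → vertexDepth (suc n) ≡ vertexDepth n + ∑ n (λ v → newArcs n (around v v))
  vertexDepth-suc n = begin
    ∑ n (depthV (suc n) A) + depthV (suc n) A (suc n)
      ≡⟨ cong (_+_ (∑ n (depthV (suc n) A))) (countArcs-around-last n (suc n)) ⟩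
    ∑ n (depthV (suc n) A) + 0
      ≡⟨ +-identityʳ _ ⟩
    ∑ n (λ v → countArcs (suc n) A (around v v))
      ≡⟨ ∑-cong′ n (λ v → countArcs-suc n (around v v)) ⟩
    ∑ n (λ v → depthV n A v + newArcs n (around v v))
      ≡⟨ ∑-distrib-+ n _ _ ⟩
    vertexDepth n + ∑ n (λ v → newArcs n (around v v)) ∎
    where open ≡-Reasoning

  arcDepth-suc : ∀ n → arcDepth (suc n)
                       ≡ arcDepth n + ∑ n (λ u → ∑ n (λ v → ind (isArc n A u v) * newArcs n (around u v)))
  arcDepth-suc n = begin
    ∑ n (λ u → ∑ n (entry u) + entry u (suc n)) + ∑ (suc n) (entry (suc n))
      ≡⟨ cong₂ _+_ (∑-cong′ n (λ u → trans (cong (_+_ (∑ n (entry u))) (lastColumn u)) (+-identityʳ _)))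
                   (∑-zero (suc n) lastRow) ⟩
    ∑ n (λ u → ∑ n (entry u)) + 0
      ≡⟨ +-identityʳ _ ⟩
    ∑ n (λ u → ∑ n (entry u))
      ≡⟨ ∑-cong′ n (λ u → trans (∑-cong n (λ {v} _ v≤n → split u v≤n)) (∑-distrib-+ n _ _)) ⟩
    ∑ n (λ u → ∑ n (λ v → ind (isArc n A u v) * depthArc n A u v)
             + ∑ n (λ v → ind (isArc n A u v) * newArcs n (around u v)))
      ≡⟨ ∑-distrib-+ n _ _ ⟩
    arcDepth n + ∑ n (λ u → ∑ n (λ v → ind (isArc n A u v) * newArcs n (around u v))) ∎
    where
    open ≡-Reasoning
    entry : ℕ → ℕ → ℕ
    entry u v = ind (isArc (suc n) A u v) * depthArc (suc n) A u v
    lastColumn : ∀ u → entry u (suc n) ≡ 0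
    lastColumn u = trans (cong (_*_ (ind (isArc (suc n) A u (suc n)))) (countArcs-around-last n u))
                         (*-zeroʳ (ind (isArc (suc n) A u (suc n))))
    lastRow : ∀ {v} → 1 ≤ v → v ≤ suc n → entry (suc n) v ≡ 0
    lastRow {v} _ v≤1+n = cong (λ b → ind b * depthArc (suc n) A (suc n) v) (isArc-backward (suc n) v≤1+n)
    split : ∀ u {v} → v ≤ n →
            entry u v ≡ ind (isArc n A u v) * depthArc n A u v + ind (isArc n A u v) * newArcs n (around u v)
    split u {v} v≤n = trans (cong₂ (λ b d → ind b * d) (isArc-suc n u v≤n) (countArcs-suc n (around u v)))
                            (*-distribˡ-+ (ind (isArc n A u v)) _ _)

  numArcs-suc-noArcInto : ∀ n → NoArcInto (suc n) → numArcs (suc n) A ≡ numArcs n A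
  numArcs-suc-noArcInto n none =
    trans (countArcs-suc n (λ _ _ → true)) (n≡0⇒m+n≡m (numArcs n A) (newArcs-noArcInto n (λ _ _ → true) none))

  vertexDepth-suc-noArcInto : ∀ n → NoArcInto (suc n) → vertexDepth (suc n) ≡ vertexDepth n
  vertexDepth-suc-noArcInto n none = trans (vertexDepth-suc n)
    (n≡0⇒m+n≡m (vertexDepth n) (∑-zero n (λ {v} _ _ → newArcs-noArcInto n (around v v) none)))

  arcDepth-suc-noArcInto : ∀ n → NoArcInto (suc n) → arcDepth (suc n) ≡ arcDepth n
  arcDepth-suc-noArcInto n none = trans (arcDepth-suc n)
    (n≡0⇒m+n≡m (arcDepth n) (∑-zero n (λ {u} _ _ → ∑-zero n (λ {v} _ _ →
      trans (cong (_*_ (ind (isArc n A u v))) (newArcs-noArcInto n (around u v) none)) (*-zeroʳ (ind (isArc n A u v)))))))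

  numArcs-suc-arcInto : ∀ n {p} → Arc p (suc n) → numArcs (suc n) A ≡ suc (numArcs n A)
  numArcs-suc-arcInto n α = trans (countArcs-suc n (λ _ _ → true))
    (trans (cong (_+_ (numArcs n A)) (newArcs-arcInto n (λ _ _ → true) α)) (+-comm (numArcs n A) 1))

  vertexDepth-suc-arcInto : ∀ n {p} → Arc p (suc n) →
                            vertexDepth (suc n) ≡ vertexDepth n + ∑ n (λ v → ind (p <ᵇ v))
  vertexDepth-suc-arcInto n {p} α = trans (vertexDepth-suc n) (cong (_+_ (vertexDepth n)) (∑-cong n λ {v} _ v≤n →
    trans (newArcs-arcInto n (around v v) α)
          (trans (cong (λ b → ind ((p <ᵇ v) ∧ b)) (≡true (<ᵇ-reflects-< v (suc n)) (s≤s v≤n)))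
                 (cong ind (∧-identityʳ (p <ᵇ v))))))

  arcDepth-suc-arcInto : ∀ n {p} → Arc p (suc n) →
                         arcDepth (suc n) ≡ arcDepth n + ∑ n (λ u → ind (p <ᵇ u) * outdeg n u)
  arcDepth-suc-arcInto n {p} α = trans (arcDepth-suc n) (cong (_+_ (arcDepth n)) (∑-cong′ n λ u → begin
    ∑ n (λ v → ind (isArc n A u v) * newArcs n (around u v))
      ≡⟨ ∑-cong n (λ {v} _ v≤n → cong (_*_ (ind (isArc n A u v)))
           (trans (newArcs-arcInto n (around u v) α)
                  (cong (λ b → ind ((p <ᵇ u) ∧ b)) (≡true (<ᵇ-reflects-< v (suc n)) (s≤s v≤n))))) ⟩
    ∑ n (λ v → ind (isArc n A u v) * ind ((p <ᵇ u) ∧ true))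
      ≡⟨ ∑-distribʳ-* n _ (λ v → ind (isArc n A u v)) ⟩
    outdeg n u * ind ((p <ᵇ u) ∧ true)
      ≡⟨ cong (λ b → outdeg n u * ind b) (∧-identityʳ (p <ᵇ u)) ⟩
    outdeg n u * ind (p <ᵇ u)
      ≡⟨ *-comm (outdeg n u) _ ⟩
    ind (p <ᵇ u) * outdeg n u ∎))
    where open ≡-Reasoning

  newBoundaryPairs : ℕ → ℕ
  newBoundaryPairs n = ∑ n (λ a → ind (boundaryArc a (suc n)))

  newBoundaryPairs-noArcInto : ∀ n → NoArcInto (suc n) → newBoundaryPairs n ≡ numArcs n A
  newBoundaryPairs-noArcInto n none =
    trans (∑-cong′ n (λ a → boundaryArc-suc-noArcInto n a (λ {k} _ → none {k}))) (sym (numArcs-outdeg n))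

  newBoundaryPairs-arcInto : ∀ n {p} → Arc p (suc n) →
                             newBoundaryPairs n ≡ ∑ n (λ a → ind (a ≤ᵇ p)) + ∑ n (λ u → ind (p <ᵇ u) * outdeg n u)
  newBoundaryPairs-arcInto n α = trans (∑-cong′ n (λ a → boundaryArc-suc-arcInto n a α)) (∑-distrib-+ n _ _)

  tStat-suc-noArcInto : ∀ n → NoArcInto (suc n) → tStat (suc n) A ≡ tStat n A +ℤ + newBoundaryPairs n
  tStat-suc-noArcInto n none = begin
    tStat (suc n) A
      ≡⟨ tStat-tForm (suc n) ⟩
    tForm (suc n) (numArcs (suc n) A) (vertexDepth (suc n)) (arcDepth (suc n))
      ≡⟨ tForm-cong (numArcs-suc-noArcInto n none) (vertexDepth-suc-noArcInto n none) (arcDepth-suc-noArcInto n none) ⟩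
    tForm (suc n) (numArcs n A) (vertexDepth n) (arcDepth n)
      ≡⟨ tForm-suc n (numArcs n A) (vertexDepth n) (arcDepth n) ⟩
    tForm n (numArcs n A) (vertexDepth n) (arcDepth n) +ℤ + numArcs n A
      ≡⟨ cong₂ _+ℤ_ (tStat-tForm n) (cong +_ (newBoundaryPairs-noArcInto n none)) ⟨
    tStat n A +ℤ + newBoundaryPairs n ∎
    where open ≡-Reasoning

  tStat-suc-arcInto : ∀ n {p} → Arc p (suc n) → tStat (suc n) A ≡ tStat n A +ℤ + newBoundaryPairs n
  tStat-suc-arcInto n {p} α = begin
    tStat (suc n) A
      ≡⟨ tStat-tForm (suc n) ⟩
    tForm (suc n) (numArcs (suc n) A) (vertexDepth (suc n)) (arcDepth (suc n))
      ≡⟨ tForm-cong (numArcs-suc-arcInto n α) (vertexDepth-suc-arcInto n α) (arcDepth-suc-arcInto n α) ⟩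
    tForm (suc n) (suc (numArcs n A)) (vertexDepth n + after) (arcDepth n + nested)
      ≡⟨ tForm-suc-suc atMost after (numArcs n A) (vertexDepth n) (arcDepth n) nested
                       (sym (∑-ind-≤ᵇ-+-∑-ind-<ᵇ n p)) ⟩
    tForm n (numArcs n A) (vertexDepth n) (arcDepth n) +ℤ + (atMost + nested)
      ≡⟨ cong₂ _+ℤ_ (tStat-tForm n) (cong +_ (newBoundaryPairs-arcInto n α)) ⟨
    tStat n A +ℤ + newBoundaryPairs n ∎
    where
    open ≡-Reasoning
    atMost after nested : ℕ
    atMost   = ∑ n (λ a → ind (a ≤ᵇ p))
    after  = ∑ n (λ a → ind (p <ᵇ a))
    nested = ∑ n (λ u → ind (p <ᵇ u) * outdeg n u)

  tStat-suc : ∀ n → tStat (suc n) A ≡ tStat n A +ℤ + newBoundaryPairs n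
  tStat-suc n with arcInto? (suc n)
  ... | inj₁ none    = tStat-suc-noArcInto n none
  ... | inj₂ (p , α) = tStat-suc-arcInto n α

  tStat≡countPairs : ∀ n → tStat n A ≡ + countPairs n boundaryArc
  tStat≡countPairs zero    = refl
  tStat≡countPairs (suc n) = begin
    tStat (suc n) A                                       ≡⟨ tStat-suc n ⟩
    tStat n A +ℤ + newBoundaryPairs n                    ≡⟨ cong (_+ℤ + newBoundaryPairs n) (tStat≡countPairs n) ⟩
    + (countPairs n boundaryArc + newBoundaryPairs n)    ≡⟨ cong +_ (countPairs-suc n boundaryArc) ⟨
    + countPairs (suc n) boundaryArc                      ∎
    where open ≡-Reasoning

mainTheorem4 : (n : ℕ) (A : Labelling) →
    (tStat n A ≡ + DStat n A) × (iStat n A ≡ EStat n A)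
mainTheorem4 n A =
  trans (tStat≡countPairs A n) (cong +_ (sym (DStat≡countPairs A n))) ,
  trans (iStat≡countPairs A n) (sym (EStat≡countPairs A n))
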